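{- Let $\Gamma$ be a 2-colored best match graph (2-cBMG) with edge set $E$ in which no two symmetric edges have a common endpoint. Let $\tilde\Gamma$ be a $\dot{\sim}$-consistent underlying oriented digraph of $\Gamma$, and label the vertices $1,2,\dots,m$ so that $i<j$ whenever $ij$ is an edge of $\tilde\Gamma$ (a topological ordering). Then: (i) the vertex $m$ is the endpoint of a unique symmetric edge of $\Gamma$; (ii) if $\ell m$ is the symmetric edge with endpoint $m$, then any two vertices $d,e\notin\{\ell,m\}$ each of which satisfies $N(\cdot)=\{m\}$ or $N(\cdot)=\{\ell\}$ are equivalent; in particular there are no two vertices $d,e\notin\{\ell,m\}$ with $N(d)=\{m\}$ and $N(e)=\{\ell\}$; (iii) if $\ell<v<m$, then $\ell v\notin E$; (iv) the topological ordering of $\tilde\Gamma$ can be rearranged (keeping $m$ as the last vertex) so that $\ell=m-1$ and, if $d_1,\dots,d_r$ are all the (pairwise equivalent) vertices $d\notin\{\ell,m\}$ with $N(d)=\{m\}$, then $d_1=m-2,\dots,d_r=m-1-r$.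
   Context: Digraphs have no loops or multiple edges; $N(x)$, $N^-(x)$ are out- and in-neighbourhoods, $N(S)=\bigcup_{s\in S}N(s)$. A 2-cBMG is a bipartite digraph (two colour classes, every edge joining different classes), not necessarily connected, satisfying: N1: for any vertices $x,y$ with $x\notin N(y)$, $y\notin N(x)$, $N(x)\cap N(N(y))=N(y)\cap N(N(x))=\emptyset$; N2: $N(N(N(x)))\subseteq N(x)$; N3: for any vertices $x,y$ with $x\notin N(N(y))$, $y\notin N(N(x))$ and $N(x)\cap N(y)\neq\emptyset$, $N^-(x)=N^-(y)$ and $N(x)\subseteq N(y)$ or $N(y)\subseteq N(x)$; N4: every vertex has an out-neighbour. Vertices $x,y$ are equivalent ($x\dot{\sim}y$) if $N(x)=N(y)$, $N^-(x)=N^-(y)$. A symmetric edge is a pair $\{x,y\}$ with $xy,yx\in E$. An underlying oriented digraph deletes exactly one of $xy,yx$ from each symmetric edge; it is $\dot{\sim}$-consistent if for $u\dot{\sim}u'$, $v\dot{\sim}v'$, $uv$ is kept iff $u'v'$ is kept. Such a digraph is acyclic and so admits a topological ordering. -}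

module Defs where

open import Data.Nat using (ℕ; suc; _+_; _≤_; _<_)
open import Data.Fin using (Fin; toℕ; fromℕ)
open import Data.Fin.Permutation using (Permutation′; _⟨$⟩ʳ_)
open import Data.Bool using (Bool; true)
open import Data.Product using (_×_; Σ; ∃; ∃-syntax)
open import Data.Sum using (_⊎_)
open import Relation.Nullary using (¬_)
open import Relation.Binary.PropositionalEquality using (_≡_; _≢_)

Digraph : ℕ → Set
Digraph m = Fin m → Fin m → Bool

Edge : {m : ℕ} → Digraph m → Fin m → Fin m → Set
Edge E x y = E x y ≡ true

module _ {m : ℕ} (E : Digraph m) where

  In-NN : Fin m → Fin m → Set
  In-NN x z = ∃[ w ] (Edge E x w × Edge E w z)

  In-NNN : Fin m → Fin m → Set
  In-NNN x z = ∃[ a ] ∃[ b ] (Edge E x a × Edge E a b × Edge E b z)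

  Bipartite : Set
  Bipartite = Σ (Fin m → Bool) λ col → ∀ x y → Edge E x y → col x ≢ col y

  N1 : Set
  N1 = ∀ x y → ¬ Edge E y x → ¬ Edge E x y →
         (¬ (∃[ z ] (Edge E x z × In-NN y z))) × (¬ (∃[ z ] (Edge E y z × In-NN x z)))

  N2 : Set
  N2 = ∀ x z → In-NNN x z → Edge E x z

  SameIn : Fin m → Fin m → Set
  SameIn x y = ∀ z → (Edge E z x → Edge E z y) × (Edge E z y → Edge E z x)

  OutSub : Fin m → Fin m → Set
  OutSub x y = ∀ z → Edge E x z → Edge E y z

  N3 : Set
  N3 = ∀ x y → ¬ In-NN y x → ¬ In-NN x y → ∃[ z ] (Edge E x z × Edge E y z) →
         SameIn x y × (OutSub x y ⊎ OutSub y x)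

  N4 : Set
  N4 = ∀ x → ∃[ y ] Edge E x y

  -- 2-colored best match graph (not necessarily connected)
  Is2cBMG : Set
  Is2cBMG = Bipartite × N1 × N2 × N3 × N4

  Equiv : Fin m → Fin m → Set
  Equiv x y = (OutSub x y × OutSub y x) × SameIn x y

  SymEdge : Fin m → Fin m → Set
  SymEdge x y = Edge E x y × Edge E y x

  SymEdgesDisjoint : Set
  SymEdgesDisjoint = ∀ x y z → SymEdge x y → SymEdge x z → y ≡ z

  OutIsSingleton : Fin m → Fin m → Set
  OutIsSingleton x v = ∀ z → (Edge E x z → z ≡ v) × (z ≡ v → Edge E x z)

  IsUnderlyingOriented : Digraph m → Set
  IsUnderlyingOriented Ẽ =
      (∀ x y → Edge Ẽ x y → Edge E x y)
    × (∀ x y → Edge E x y → ¬ Edge E y x → Edge Ẽ x y)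
    × (∀ x y → SymEdge x y → (Edge Ẽ x y × ¬ Edge Ẽ y x) ⊎ (Edge Ẽ y x × ¬ Edge Ẽ x y))

  EquivConsistent : Digraph m → Set
  EquivConsistent Ẽ = ∀ u u' v v' → Equiv u u' → Equiv v v' →
                        (Edge Ẽ u v → Edge Ẽ u' v') × (Edge Ẽ u' v' → Edge Ẽ u v)

-- The labelling of Fin m (i ↦ toℕ i + 1) is a topological ordering of Ẽ
IsTopological : {m : ℕ} → Digraph m → Set
IsTopological Ẽ = ∀ i j → Edge Ẽ i j → toℕ i < toℕ j

-- the relabelling σ (new label of v is σ v) is a topological ordering of Ẽ
IsTopologicalVia : {m : ℕ} → Digraph m → Permutation′ m → Set
IsTopologicalVia Ẽ σ = ∀ i j → Edge Ẽ i j → toℕ (σ ⟨$⟩ʳ i) < toℕ (σ ⟨$⟩ʳ j)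

-- The last vertex m has no out-edge in Ẽ, so all its out-edges in Γ are symmetric; N4 supplies one and
-- disjointness of symmetric edges makes it unique, so N(m) = {ℓ}.  For ℓ → w → x, N2 applied to
-- m → ℓ → w → x gives m → x, so x = ℓ; thus {ℓ , w} is symmetric and w = m, i.e. N(ℓ) = {m}.  Part (ii) then follows from N1 and N3, and (iii) is
-- immediate.  For (iv) the vertices are re-sorted by the key (weight, old label), where m, ℓ, the
-- vertices d with N(d) = {m}, and all others get weights 3, 2, 1, 0; every edge of Ẽ raises this key,
-- since the out-edges of ℓ and of those d all end at m.
module Submission where

open import Defs
open import Data.Bool using (true) renaming (_≟_ to _≟ᵇ_)
open import Data.Empty using (⊥; ⊥-elim)
open import Data.Fin using (Fin; zero; suc; toℕ; fromℕ; fromℕ<; punchOut)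
open import Data.Fin.Permutation using (Permutation′; _⟨$⟩ʳ_; _⟨$⟩ˡ_; permutation; inverseʳ)
open import Data.Fin.Properties
  using (_≟_; all?; any?; injective⇒≤; punchOut-injective; toℕ-fromℕ; toℕ-fromℕ<; toℕ-injective; toℕ<n)
open import Data.Nat using (ℕ; zero; suc; _+_; _≤_; _<_; z≤n; s≤s; s≤s⁻¹; z<s; s<s)
  renaming (_≟_ to _≟ℕ_)
open import Data.Nat.Properties
  using (<-strictTotalOrder; m≤n⇒m≤1+n; m≤n⇒m<n∨m≡n; n<1+n; <-irrefl; <-asym; <-trans; <⇒≱; 1+n≢n; 1+n≰n;
         suc-injective; +-comm)
open import Data.Product using (_×_; Σ; ∃; ∃-syntax; _,_; proj₁; proj₂; swap; uncurry)
open import Data.Product.Relation.Binary.Lex.Strict using (×-strictTotalOrder)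
open import Data.Sum using (_⊎_; inj₁; inj₂)
open import Function using (_∘_)
open import Level using (Level; 0ℓ)
open import Function.Definitions using (Injective)
open import Relation.Binary using (StrictTotalOrder; tri<; tri≈; tri>)
open import Relation.Binary.PropositionalEquality using (_≡_; _≢_; refl; sym; trans; cong; subst; subst₂)
open import Relation.Nullary using (¬_; Dec; yes; no)
open import Relation.Nullary.Decidable using (_×-dec_; _→-dec_; decidable-stable)
open import Relation.Unary using (Pred; Decidable; _⊆_)

private
  variable p q : Level

count : ∀ {N} {P : Pred (Fin N) p} → Decidable P → ℕ
count {N = zero}  P? = 0
count {N = suc N} P? with P? zero
... | yes _ = suc (count (P? ∘ suc))
... | no  _ = count (P? ∘ suc)

count≤ : ∀ {N} {P : Pred (Fin N) p} (P? : Decidable P) → count P? ≤ N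
count≤ {N = zero}  P? = z≤n
count≤ {N = suc N} P? with P? zero
... | yes _ = s≤s (count≤ (P? ∘ suc))
... | no  _ = m≤n⇒m≤1+n (count≤ (P? ∘ suc))

count< : ∀ {N} {P : Pred (Fin N) p} (P? : Decidable P) {x} → ¬ P x → count P? < N
count< {N = suc N} P? {zero} ¬Px with P? zero
... | yes Px = ⊥-elim (¬Px Px)
... | no  _  = s≤s (count≤ (P? ∘ suc))
count< {N = suc N} P? {suc x} ¬Px with P? zero
... | yes _ = s≤s (count< (P? ∘ suc) ¬Px)
... | no  _ = m≤n⇒m≤1+n (count< (P? ∘ suc) ¬Px)

count-mono : ∀ {N} {P : Pred (Fin N) p} {Q : Pred (Fin N) q} (P? : Decidable P) (Q? : Decidable Q) →
             P ⊆ Q → count P? ≤ count Q?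
count-mono {N = zero}  P? Q? P⊆Q = z≤n
count-mono {N = suc N} P? Q? P⊆Q with P? zero | Q? zero
... | yes _  | yes _  = s≤s (count-mono (P? ∘ suc) (Q? ∘ suc) P⊆Q)
... | yes Px | no ¬Qx = ⊥-elim (¬Qx (P⊆Q Px))
... | no  _  | yes _  = m≤n⇒m≤1+n (count-mono (P? ∘ suc) (Q? ∘ suc) P⊆Q)
... | no  _  | no  _  = count-mono (P? ∘ suc) (Q? ∘ suc) P⊆Q

count-mono-< : ∀ {N} {P : Pred (Fin N) p} {Q : Pred (Fin N) q} (P? : Decidable P) (Q? : Decidable Q) →
               P ⊆ Q → ∀ {x} → Q x → ¬ P x → count P? < count Q?
count-mono-< {N = suc N} P? Q? P⊆Q {zero} Qx ¬Px with P? zero | Q? zero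
... | yes Px | _      = ⊥-elim (¬Px Px)
... | no  _  | yes _  = s≤s (count-mono (P? ∘ suc) (Q? ∘ suc) P⊆Q)
... | no  _  | no ¬Qx = ⊥-elim (¬Qx Qx)
count-mono-< {N = suc N} P? Q? P⊆Q {suc x} Qx ¬Px with P? zero | Q? zero
... | yes _  | yes _  = s≤s (count-mono-< (P? ∘ suc) (Q? ∘ suc) P⊆Q Qx ¬Px)
... | yes Py | no ¬Qy = ⊥-elim (¬Qy (P⊆Q Py))
... | no  _  | yes _  = <-trans (count-mono-< (P? ∘ suc) (Q? ∘ suc) P⊆Q Qx ¬Px) (n<1+n _)
... | no  _  | no  _  = count-mono-< (P? ∘ suc) (Q? ∘ suc) P⊆Q Qx ¬Px

injective⇒surjective : ∀ {N} (f : Fin N → Fin N) → Injective _≡_ _≡_ f → ∀ y → ∃ λ x → f x ≡ y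
injective⇒surjective {suc N} f f-injective y with any? (λ x → f x ≟ y)
... | yes hit = hit
... | no miss = ⊥-elim (1+n≰n (injective⇒≤ punched-injective))
  where
  f≢y : ∀ x → y ≢ f x
  f≢y x = miss ∘ (x ,_) ∘ sym

  punched : Fin (suc N) → Fin N
  punched x = punchOut (f≢y x)

  punched-injective : Injective _≡_ _≡_ punched
  punched-injective {i} {j} = f-injective ∘ punchOut-injective (f≢y i) (f≢y j)

-- The permutation listing Fin N in increasing order of an injective key: v is sent to the number of
-- elements with a smaller key.
module Ranking {a ℓ₁ ℓ₂} (O : StrictTotalOrder a ℓ₁ ℓ₂) {N : ℕ}
  (key : Fin N → StrictTotalOrder.Carrier O)
  (key-injective : ∀ {u v} → StrictTotalOrder._≈_ O (key u) (key v) → u ≡ v) where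

  open StrictTotalOrder O using (compare; irrefl; module Eq)
    renaming (_<_ to _⊏_; _<?_ to _⊏?_; trans to ⊏-trans)

  rank : Fin N → ℕ
  rank v = count (λ u → key u ⊏? key v)

  rank<N : ∀ v → rank v < N
  rank<N v = count< (λ u → key u ⊏? key v) {v} (irrefl Eq.refl)

  rank-mono : ∀ {u v} → key u ⊏ key v → rank u < rank v
  rank-mono {u} {v} u⊏v =
    count-mono-< (λ w → key w ⊏? key u) (λ w → key w ⊏? key v) (λ w⊏u → ⊏-trans w⊏u u⊏v)
                 u⊏v (irrefl Eq.refl)

  rank-injective : Injective _≡_ _≡_ rank
  rank-injective {u} {v} same with compare (key u) (key v)
  ... | tri< u⊏v _ _ = ⊥-elim (<-irrefl same (rank-mono u⊏v))
  ... | tri≈ _ u≈v _ = key-injective u≈v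
  ... | tri> _ _ v⊏u = ⊥-elim (<-irrefl (sym same) (rank-mono v⊏u))

  rank-as-Fin : Fin N → Fin N
  rank-as-Fin v = fromℕ< (rank<N v)

  rank-as-Fin-injective : Injective _≡_ _≡_ rank-as-Fin
  rank-as-Fin-injective {u} {v} same =
    rank-injective (trans (sym (toℕ-fromℕ< (rank<N u))) (trans (cong toℕ same) (toℕ-fromℕ< (rank<N v))))

  ranking : Permutation′ N
  ranking = permutation rank-as-Fin (proj₁ ∘ onto) (proj₂ ∘ onto)
                        (rank-as-Fin-injective ∘ proj₂ ∘ onto ∘ rank-as-Fin)
    where
    onto : ∀ y → ∃ λ x → rank-as-Fin x ≡ y
    onto = injective⇒surjective rank-as-Fin rank-as-Fin-injective

  position : Fin N → ℕ
  position v = toℕ (ranking ⟨$⟩ʳ v)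

  position≡rank : ∀ v → position v ≡ rank v
  position≡rank v = toℕ-fromℕ< (rank<N v)

  position<N : ∀ v → position v < N
  position<N v = subst (_< N) (sym (position≡rank v)) (rank<N v)

  position-mono : ∀ {u v} → key u ⊏ key v → position u < position v
  position-mono {u} {v} = subst₂ _<_ (sym (position≡rank u)) (sym (position≡rank v)) ∘ rank-mono

  position-surjective : ∀ {j} → j < N → ∃ λ u → position u ≡ j
  position-surjective j<N = ranking ⟨$⟩ˡ fromℕ< j<N , trans (cong toℕ (inverseʳ ranking)) (toℕ-fromℕ< j<N)

  count≤position : ∀ {P : Pred (Fin N) p} (P? : Decidable P) {v} →
                   (∀ {u} → P u → key u ⊏ key v) → count P? ≤ position v
  count≤position P? {v} P⊆below = subst (count P? ≤_) (sym (position≡rank v)) (count-mono P? _ P⊆below)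

  position<count : ∀ {P : Pred (Fin N) p} (P? : Decidable P) {v} → P v →
                   (∀ {u} → key u ⊏ key v → P u) → position v < count P?
  position<count P? {v} Pv below⊆P =
    subst (_< count P?) (sym (position≡rank v)) (count-mono-< _ P? below⊆P Pv (irrefl Eq.refl))

  private
    successor-≢ : ∀ {u v} → position u ≡ suc (position v) → u ≢ v
    successor-≢ next refl = 1+n≢n (sym next)

    successor-⋢ : ∀ {u v} → position u ≡ suc (position v) → ¬ key u ⊏ key v
    successor-⋢ {u} {v} next u⊏v =
      <-asym (n<1+n (position v)) (subst (_< position v) next (position-mono u⊏v))

  position-greatest : ∀ {v} → (∀ u → u ≢ v → key u ⊏ key v) → suc (position v) ≡ N
  position-greatest {v} v-greatest with m≤n⇒m<n∨m≡n (position<N v)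
  ... | inj₂ last = last
  ... | inj₁ gap with position-surjective gap
  ... | u , next = ⊥-elim (successor-⋢ next (v-greatest u (successor-≢ next)))

  position-second-greatest : ∀ {v w} → key v ⊏ key w → (∀ u → u ≢ w → key u ⊏ key w) →
                             (∀ u → u ≢ v → u ≢ w → key u ⊏ key v) → suc (suc (position v)) ≡ N
  position-second-greatest {v} {w} v⊏w w-greatest v-second
    with m≤n⇒m<n∨m≡n (subst (suc (suc (position v)) ≤_) (position-greatest w-greatest) (s≤s (position-mono v⊏w)))
  ... | inj₂ last = last
  ... | inj₁ gap with position-surjective (<-trans (n<1+n _) gap)
  ... | u , next = ⊥-elim (successor-⋢ next (v-second u (successor-≢ next) u≢w))
    where
    u≢w : u ≢ w
    u≢w refl = <-irrefl (trans (cong suc (sym next)) (position-greatest w-greatest)) gap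

module _ {N : ℕ} (E : Digraph N) where

  edge? : ∀ x y → Dec (Edge E x y)
  edge? x y = E x y ≟ᵇ true

  out-singleton? : ∀ x v → Dec (OutIsSingleton E x v)
  out-singleton? x v = all? (λ z → (edge? x z →-dec z ≟ v) ×-dec (z ≟ v →-dec edge? x z))

  -- N(N(e)) = N(v) ⊆ {u} does not contain d, and symmetrically, so N3 applies to d and e.
  equiv-of-same-singleton-out : N3 E → ∀ {u v d e} → (∀ w → Edge E v w → w ≡ u) → d ≢ u → e ≢ u →
                                OutIsSingleton E d v → OutIsSingleton E e v → Equiv E d e
  equiv-of-same-singleton-out n3 {u} {v} {d} {e} v→u d≢u e≢u d→v e→v =
    (same-out d→v e→v , same-out e→v d→v) ,
    proj₁ (n3 d e (not-in-NN e→v d≢u) (not-in-NN d→v e≢u) (v , to-v d→v , to-v e→v))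
    where
    to-v : ∀ {x} → OutIsSingleton E x v → Edge E x v
    to-v x→v = proj₂ (x→v v) refl

    same-out : ∀ {x y} → OutIsSingleton E x v → OutIsSingleton E y v → OutSub E x y
    same-out x→v y→v z x→z = proj₂ (y→v z) (proj₁ (x→v z) x→z)

    not-in-NN : ∀ {x y} → OutIsSingleton E y v → x ≢ u → ¬ In-NN E y x
    not-in-NN {x} y→v x≢u (w , y→w , w→x) =
      x≢u (v→u x (subst (λ z → Edge E z x) (proj₁ (y→v w) y→w) w→x))

  no-crossed-singleton-outs : N1 E → ∀ {ℓ v d e} → Edge E ℓ v → d ≢ ℓ → e ≢ v →
                              OutIsSingleton E d v → OutIsSingleton E e ℓ → ⊥
  no-crossed-singleton-outs n1 {ℓ} {v} ℓ→v d≢ℓ e≢v d→v e→ℓ =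
    proj₁ (n1 _ _ (d≢ℓ ∘ proj₁ (e→ℓ _)) (e≢v ∘ proj₁ (d→v _)))
          (v , proj₂ (d→v v) refl , ℓ , proj₂ (e→ℓ ℓ) refl , ℓ→v)

  out-of-symmetric-partner : N2 E → N4 E → SymEdgesDisjoint E → ∀ {ℓ v} → SymEdge E ℓ v →
                             (∀ w → Edge E v w → w ≡ ℓ) → ∀ w → Edge E ℓ w → w ≡ v
  out-of-symmetric-partner n2 n4 disjoint {ℓ} {v} ℓv v→ℓ w ℓ→w with n4 w
  ... | x , w→x =
    disjoint ℓ w v (ℓ→w , subst (Edge E w) (v→ℓ x (n2 v x (ℓ , w , proj₂ ℓv , ℓ→w , w→x))) w→x) ℓv

module LastVertex (n : ℕ) (E Ẽ : Digraph (suc n))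
  (n1 : N1 E) (n2 : N2 E) (n3 : N3 E) (n4 : N4 E) (disjoint : SymEdgesDisjoint E)
  (Ẽ⊆E : ∀ x y → Edge Ẽ x y → Edge E x y)
  (keep : ∀ x y → Edge E x y → ¬ Edge E y x → Edge Ẽ x y)
  (orient : ∀ x y → SymEdge E x y → (Edge Ẽ x y × ¬ Edge Ẽ y x) ⊎ (Edge Ẽ y x × ¬ Edge Ẽ x y))
  (topological : IsTopological Ẽ) where

  m : Fin (suc n)
  m = fromℕ n

  no-oriented-out-of-m : ∀ w → ¬ Edge Ẽ m w
  no-oriented-out-of-m w m→w =
    <⇒≱ (subst (_< toℕ w) (toℕ-fromℕ n) (topological m w m→w)) (s≤s⁻¹ (toℕ<n w))

  out-of-m-symmetric : ∀ w → Edge E m w → Edge E w m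
  out-of-m-symmetric w m→w = decidable-stable (edge? E w m) (no-oriented-out-of-m w ∘ keep m w m→w)

  unique-symmetric-partner : ∃[ ℓ ] (SymEdge E ℓ m × (∀ ℓ' → SymEdge E ℓ' m → ℓ' ≡ ℓ))
  unique-symmetric-partner with n4 m
  ... | w , m→w = w , swap mw , λ ℓ' ℓ'm → disjoint m ℓ' w (swap ℓ'm) mw
    where
    mw : SymEdge E m w
    mw = m→w , out-of-m-symmetric w m→w

  module Partner (ℓ : Fin (suc n)) (ℓm : SymEdge E ℓ m) where

    out-of-m : ∀ w → Edge E m w → w ≡ ℓ
    out-of-m w m→w = disjoint m w ℓ (m→w , out-of-m-symmetric w m→w) (swap ℓm)

    out-of-ℓ : ∀ w → Edge E ℓ w → w ≡ m
    out-of-ℓ = out-of-symmetric-partner E n2 n4 disjoint ℓm out-of-m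

    ℓ<n : toℕ ℓ < n
    ℓ<n with orient ℓ m ℓm
    ... | inj₁ (ℓ→m , _) = subst (toℕ ℓ <_) (toℕ-fromℕ n) (topological ℓ m ℓ→m)
    ... | inj₂ (m→ℓ , _) = ⊥-elim (no-oriented-out-of-m ℓ m→ℓ)

    ℓ≢m : ℓ ≢ m
    ℓ≢m refl = <-irrefl (toℕ-fromℕ n) ℓ<n

    singleton-outs-equiv : ∀ d e → d ≢ ℓ → d ≢ m → e ≢ ℓ → e ≢ m →
                           (OutIsSingleton E d m ⊎ OutIsSingleton E d ℓ) →
                           (OutIsSingleton E e m ⊎ OutIsSingleton E e ℓ) → Equiv E d e
    singleton-outs-equiv d e d≢ℓ d≢m e≢ℓ e≢m (inj₁ d→m) (inj₁ e→m) =
      equiv-of-same-singleton-out E n3 out-of-m d≢ℓ e≢ℓ d→m e→m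
    singleton-outs-equiv d e d≢ℓ d≢m e≢ℓ e≢m (inj₂ d→ℓ) (inj₂ e→ℓ) =
      equiv-of-same-singleton-out E n3 out-of-ℓ d≢m e≢m d→ℓ e→ℓ
    singleton-outs-equiv d e d≢ℓ d≢m e≢ℓ e≢m (inj₁ d→m) (inj₂ e→ℓ) =
      ⊥-elim (no-crossed-singleton-outs E n1 (proj₁ ℓm) d≢ℓ e≢m d→m e→ℓ)
    singleton-outs-equiv d e d≢ℓ d≢m e≢ℓ e≢m (inj₂ d→ℓ) (inj₁ e→m) =
      ⊥-elim (no-crossed-singleton-outs E n1 (proj₁ ℓm) e≢ℓ d≢m e→m d→ℓ)

    no-crossed-singleton-outs-at-m : ¬ (∃[ d ] ∃[ e ] (d ≢ ℓ × d ≢ m × e ≢ ℓ × e ≢ m ×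
                                       OutIsSingleton E d m × OutIsSingleton E e ℓ))
    no-crossed-singleton-outs-at-m (d , e , d≢ℓ , _ , _ , e≢m , d→m , e→ℓ) =
      no-crossed-singleton-outs E n1 (proj₁ ℓm) d≢ℓ e≢m d→m e→ℓ

    no-edge-below-m : ∀ v → toℕ v < n → ¬ Edge E ℓ v
    no-edge-below-m v v<n ℓ→v =
      <-irrefl (toℕ-fromℕ n) (subst (λ z → toℕ z < n) (out-of-ℓ v ℓ→v) v<n)

    Pendant : Fin (suc n) → Set
    Pendant d = d ≢ ℓ × d ≢ m × OutIsSingleton E d m

    data Role (v : Fin (suc n)) : Set where
      top     : v ≡ m → Role v
      partner : v ≡ ℓ → v ≢ m → Role v
      pendant : Pendant v → Role v
      other   : v ≢ ℓ → v ≢ m → ¬ OutIsSingleton E v m → Role v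

    role : ∀ v → Role v
    role v with v ≟ m | v ≟ ℓ | out-singleton? E v m
    ... | yes v≡m | _       | _       = top v≡m
    ... | no v≢m  | yes v≡ℓ | _       = partner v≡ℓ v≢m
    ... | no v≢m  | no v≢ℓ  | yes v→m = pendant (v≢ℓ , v≢m , v→m)
    ... | no v≢m  | no v≢ℓ  | no ¬v→m = other v≢ℓ v≢m ¬v→m

    weight : ∀ {v} → Role v → ℕ
    weight (top _)       = 3
    weight (partner _ _) = 2
    weight (pendant _)   = 1
    weight (other _ _ _) = 0

    Other : Fin (suc n) → Set
    Other v = weight (role v) ≡ 0

    weight-m : weight (role m) ≡ 3
    weight-m with role m
    ... | top _                 = refl
    ... | partner _ m≢m         = ⊥-elim (m≢m refl)
    ... | pendant (_ , m≢m , _) = ⊥-elim (m≢m refl)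
    ... | other _ m≢m _         = ⊥-elim (m≢m refl)

    weight-ℓ : weight (role ℓ) ≡ 2
    weight-ℓ with role ℓ
    ... | top ℓ≡m               = ⊥-elim (ℓ≢m ℓ≡m)
    ... | partner _ _           = refl
    ... | pendant (ℓ≢ℓ , _ , _) = ⊥-elim (ℓ≢ℓ refl)
    ... | other ℓ≢ℓ _ _         = ⊥-elim (ℓ≢ℓ refl)

    weight-pendant : ∀ {d} → Pendant d → weight (role d) ≡ 1
    weight-pendant {d} (d≢ℓ , d≢m , d→m) with role d
    ... | top d≡m         = ⊥-elim (d≢m d≡m)
    ... | partner d≡ℓ _   = ⊥-elim (d≢ℓ d≡ℓ)
    ... | pendant _       = refl
    ... | other _ _ ¬d→m  = ⊥-elim (¬d→m d→m)

    weight-other : ∀ {d} → d ≢ ℓ → d ≢ m → ¬ OutIsSingleton E d m → Other d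
    weight-other {d} d≢ℓ d≢m ¬d→m with role d
    ... | top d≡m                 = ⊥-elim (d≢m d≡m)
    ... | partner d≡ℓ _           = ⊥-elim (d≢ℓ d≡ℓ)
    ... | pendant (_ , _ , d→m)   = ⊥-elim (¬d→m d→m)
    ... | other _ _ _             = refl

    order : StrictTotalOrder 0ℓ 0ℓ 0ℓ
    order = ×-strictTotalOrder <-strictTotalOrder <-strictTotalOrder

    open StrictTotalOrder order using () renaming (_<_ to _⊏_)

    key : Fin (suc n) → ℕ × ℕ
    key v = weight (role v) , toℕ v

    open Ranking order key (toℕ-injective ∘ proj₂)

    key-below-m : ∀ u → u ≢ m → key u ⊏ key m
    key-below-m u u≢m rewrite weight-m with role u
    ... | top u≡m       = ⊥-elim (u≢m u≡m)
    ... | partner _ _   = inj₁ (s<s (s<s z<s))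
    ... | pendant _     = inj₁ (s<s z<s)
    ... | other _ _ _   = inj₁ z<s

    key-below-ℓ : ∀ u → u ≢ ℓ → u ≢ m → key u ⊏ key ℓ
    key-below-ℓ u u≢ℓ u≢m rewrite weight-ℓ with role u
    ... | top u≡m       = ⊥-elim (u≢m u≡m)
    ... | partner u≡ℓ _ = ⊥-elim (u≢ℓ u≡ℓ)
    ... | pendant _     = inj₁ (s<s z<s)
    ... | other _ _ _   = inj₁ z<s

    others-downward : ∀ {u v} → Other v → key u ⊏ key v → Other u
    others-downward v-other (inj₁ lighter) = ⊥-elim (<⇒≱ lighter (subst (_≤ _) (sym v-other) z≤n))
    others-downward v-other (inj₂ (same-weight , _)) = trans same-weight v-other

    key-increasing : ∀ i j → Edge Ẽ i j → key i ⊏ key j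
    key-increasing i j i→j = by-role (role i)
      where
      by-role : Role i → key i ⊏ key j
      by-role (top refl) = ⊥-elim (no-oriented-out-of-m j i→j)
      by-role (partner refl _) rewrite out-of-ℓ j (Ẽ⊆E i j i→j) = key-below-m ℓ ℓ≢m
      by-role (pendant (_ , i≢m , i→m)) rewrite proj₁ (i→m j) (Ẽ⊆E i j i→j) = key-below-m i i≢m
      by-role (other i≢ℓ i≢m ¬i→m) rewrite weight-other i≢ℓ i≢m ¬i→m with weight (role j)
      ... | zero  = inj₂ (refl , topological i j i→j)
      ... | suc _ = inj₁ z<s

    position-m : position m ≡ n
    position-m = suc-injective (position-greatest key-below-m)

    position-ℓ : suc (position ℓ) ≡ n
    position-ℓ = suc-injective (position-second-greatest (key-below-m ℓ ℓ≢m) key-below-m key-below-ℓ)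

    before-ℓ⇒+2≤n : ∀ {d} → position d < position ℓ → position d + 2 ≤ n
    before-ℓ⇒+2≤n {d} d<ℓ = subst₂ _≤_ (+-comm 2 (position d)) position-ℓ (s≤s d<ℓ)

    +2≤n⇒before-ℓ : ∀ {d} → position d + 2 ≤ n → position d < position ℓ
    +2≤n⇒before-ℓ {d} d+2≤n = s≤s⁻¹ (subst₂ _≤_ (+-comm (position d) 2) (sym position-ℓ) d+2≤n)

    other? : Decidable Other
    other? u = weight (role u) ≟ℕ 0

    others : ℕ
    others = count other?

    pendant⇒position : ∀ {d} → Pendant d → others ≤ position d × position d + 2 ≤ n
    pendant⇒position {d} d-pendant@(d≢ℓ , d≢m , _) =
      count≤position other? (λ u-other → inj₁ (subst₂ _<_ (sym u-other) (sym (weight-pendant d-pendant)) z<s)) ,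
      before-ℓ⇒+2≤n (position-mono (key-below-ℓ d d≢ℓ d≢m))

    position⇒pendant : ∀ {d} → others ≤ position d → position d + 2 ≤ n → Pendant d
    position⇒pendant {d} after-others before-ℓ = by-role (role d)
      where
      by-role : Role d → Pendant d
      by-role (top refl)           = ⊥-elim (<-asym (+2≤n⇒before-ℓ before-ℓ) (position-mono (key-below-m ℓ ℓ≢m)))
      by-role (partner refl _)     = ⊥-elim (<-irrefl refl (+2≤n⇒before-ℓ before-ℓ))
      by-role (pendant d-pendant)  = d-pendant
      by-role (other d≢ℓ d≢m ¬d→m) =
        ⊥-elim (<⇒≱ (position<count other? d-other (others-downward d-other)) after-others)
        where
        d-other : Other d
        d-other = weight-other d≢ℓ d≢m ¬d→m

    reordering : Σ (Permutation′ (suc n)) λ σ →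
                   IsTopologicalVia Ẽ σ
                 × σ ⟨$⟩ʳ m ≡ m
                 × toℕ (σ ⟨$⟩ʳ ℓ) + 1 ≡ n
                 × ∃[ k ] (∀ d → (Pendant d → k ≤ toℕ (σ ⟨$⟩ʳ d) × toℕ (σ ⟨$⟩ʳ d) + 2 ≤ n)
                                × (k ≤ toℕ (σ ⟨$⟩ʳ d) × toℕ (σ ⟨$⟩ʳ d) + 2 ≤ n → Pendant d))
    reordering =
      ranking ,
      (λ i j → position-mono ∘ key-increasing i j) ,
      toℕ-injective (trans position-m (sym (toℕ-fromℕ n))) ,
      trans (+-comm (position ℓ) 1) position-ℓ ,
      others , λ d → pendant⇒position , uncurry position⇒pendant

proposition6 : (n : ℕ) (E Ẽ : Digraph (suc n)) →
    Is2cBMG E → SymEdgesDisjoint E →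
    IsUnderlyingOriented E Ẽ → EquivConsistent E Ẽ → IsTopological Ẽ →
    (∃[ ℓ ] (SymEdge E ℓ (fromℕ n) × (∀ ℓ' → SymEdge E ℓ' (fromℕ n) → ℓ' ≡ ℓ)))
    × (∀ ℓ → SymEdge E ℓ (fromℕ n) →
        ((∀ d e → d ≢ ℓ → d ≢ fromℕ n → e ≢ ℓ → e ≢ fromℕ n →
            (OutIsSingleton E d (fromℕ n) ⊎ OutIsSingleton E d ℓ) →
            (OutIsSingleton E e (fromℕ n) ⊎ OutIsSingleton E e ℓ) →
            Equiv E d e)
         × (¬ (∃[ d ] ∃[ e ] (d ≢ ℓ × d ≢ fromℕ n × e ≢ ℓ × e ≢ fromℕ n ×
                 OutIsSingleton E d (fromℕ n) × OutIsSingleton E e ℓ))))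
      × (∀ v → toℕ ℓ < toℕ v → toℕ v < n → ¬ Edge E ℓ v)
      × (Σ (Permutation′ (suc n)) λ σ →
           IsTopologicalVia Ẽ σ
         × σ ⟨$⟩ʳ fromℕ n ≡ fromℕ n
         × toℕ (σ ⟨$⟩ʳ ℓ) + 1 ≡ n
         × ∃[ k ] (∀ d →
             ((d ≢ ℓ × d ≢ fromℕ n × OutIsSingleton E d (fromℕ n)) →
                (k ≤ toℕ (σ ⟨$⟩ʳ d) × toℕ (σ ⟨$⟩ʳ d) + 2 ≤ n))
           × ((k ≤ toℕ (σ ⟨$⟩ʳ d) × toℕ (σ ⟨$⟩ʳ d) + 2 ≤ n) →
                (d ≢ ℓ × d ≢ fromℕ n × OutIsSingleton E d (fromℕ n))))))
proposition6 n E Ẽ (_ , n1 , n2 , n3 , n4) disjoint (Ẽ⊆E , keep , orient) _ topological =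
  unique-symmetric-partner ,
  λ ℓ ℓm → let open Partner ℓ ℓm in
    (singleton-outs-equiv , no-crossed-singleton-outs-at-m) ,
    (λ v _ → no-edge-below-m v) ,
    reordering
  where open LastVertex n E Ẽ n1 n2 n3 n4 disjoint Ẽ⊆E keep orient topological
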